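{- Let $\sigma=\exists x\,\sigma_0(x)$ and $\sigma'=\exists y\,(\mathsf{wb}(y)\wedge\sigma_0'(y))$ be 1-$\Sigma_1$-sentences (so $\sigma'$ is well-behaved). Then: (a) if $\mathbb{N}\models\sigma\leq\sigma'$, then $\mathsf{R}_0\vdash\neg(\sigma'<\sigma)$; (b) if $\mathbb{N}\models\sigma<\sigma'$, then $\mathsf{R}_0\vdash\neg(\sigma'\leq\sigma)$.
   Context: $\mathbb{L}_{\sf a}=\{0,\mathsf{S},+,\times,\leq\}$ with $\leq$ primitive; $x<y$ abbreviates $x\leq y\wedge x\neq y$. $\mathsf{R}_0$ is the $\mathbb{L}_{\sf a}$-theory with axioms, for all $m,n\in\omega$: $\overline{m}+\overline{n}=\overline{m+n}$; $\overline{m}\times\overline{n}=\overline{m\times n}$; $\overline{m}\neq\overline{n}$ if $m\neq n$; $\forall x\,(x\leq\overline{n}\to\bigvee_{i\leq n}x=\overline{i})$; $\overline{m}\leq\overline{n}$ if $m\leq n$ ($\overline{n}$ numerals). A 1-$\Sigma_1$-sentence is one of the form $\exists x\,\varphi_0(x)$ with $\varphi_0$ a $\Delta_0$ (bounded) formula. $\mathsf{wb}(x)$ is the formula $0\leq x\wedge\forall y<x\;\mathsf{S}y\leq x$. Witness comparison: for $\varphi=\exists x\,\varphi_0(x)$ and $\psi=\exists y\,\psi_0(y)$, $\varphi\leq\psi$ is $\exists x\,(\varphi_0(x)\wedge\forall y<x\,\neg\psi_0(y))$ and $\varphi<\psi$ is $\exists x\,(\varphi_0(x)\wedge\forall y\leq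 x\,\neg\psi_0(y))$ (here for $\sigma'$, $\psi_0(y)$ is $\mathsf{wb}(y)\wedge\sigma_0'(y)$). -}

module Defs where

open import Data.Nat using (ℕ; zero; suc; _+_; _*_; _≤_)
open import Data.Fin using (Fin; zero; suc)
open import Data.List using (List; []; _∷_; map)
open import Data.List.Membership.Propositional using (_∈_)
open import Data.List.Relation.Unary.All using (All)
open import Data.Product using (Σ; _×_; _,_)
open import Data.Sum using (_⊎_)
open import Data.Empty using (⊥)
open import Relation.Binary.PropositionalEquality using (_≡_)
open import Relation.Nullary using (¬_)

infixl 7 _`*_
infixl 6 _`+_
infix  4 _`≐_ _`≼_ _`<_
infixr 3 _`∧_
infixr 2 _`∨_
infixr 1 _`⇒_
infix 0 _⊢ₜ_

data Tm (n : ℕ) : Set where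
  var  : Fin n → Tm n
  `0   : Tm n
  `S   : Tm n → Tm n
  _`+_ : Tm n → Tm n → Tm n
  _`*_ : Tm n → Tm n → Tm n

data Fm (n : ℕ) : Set where
  _`≐_ : Tm n → Tm n → Fm n
  _`≼_ : Tm n → Tm n → Fm n
  `⊥   : Fm n
  _`⇒_ : Fm n → Fm n → Fm n
  _`∧_ : Fm n → Fm n → Fm n
  _`∨_ : Fm n → Fm n → Fm n
  `∀   : Fm (suc n) → Fm n
  `∃   : Fm (suc n) → Fm n

`¬ : ∀ {n} → Fm n → Fm n
`¬ φ = φ `⇒ `⊥

_`<_ : ∀ {n} → Tm n → Tm n → Fm n
s `< t = (s `≼ t) `∧ `¬ (s `≐ t)

num : ∀ {n} → ℕ → Tm n
num zero    = `0
num (suc k) = `S (num k)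

ext : ∀ {n m} → (Fin n → Fin m) → Fin (suc n) → Fin (suc m)
ext ρ zero    = zero
ext ρ (suc i) = suc (ρ i)

renT : ∀ {n m} → (Fin n → Fin m) → Tm n → Tm m
renT ρ (var i)  = var (ρ i)
renT ρ `0       = `0
renT ρ (`S t)   = `S (renT ρ t)
renT ρ (s `+ t) = renT ρ s `+ renT ρ t
renT ρ (s `* t) = renT ρ s `* renT ρ t

ren : ∀ {n m} → (Fin n → Fin m) → Fm n → Fm m
ren ρ (s `≐ t) = renT ρ s `≐ renT ρ t
ren ρ (s `≼ t) = renT ρ s `≼ renT ρ t
ren ρ `⊥       = `⊥
ren ρ (φ `⇒ ψ) = ren ρ φ `⇒ ren ρ ψ
ren ρ (φ `∧ ψ) = ren ρ φ `∧ ren ρ ψ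
ren ρ (φ `∨ ψ) = ren ρ φ `∨ ren ρ ψ
ren ρ (`∀ φ)   = `∀ (ren (ext ρ) φ)
ren ρ (`∃ φ)   = `∃ (ren (ext ρ) φ)

wkT : ∀ {n} → Tm n → Tm (suc n)
wkT = renT suc

wk : ∀ {n} → Fm n → Fm (suc n)
wk = ren suc

exts : ∀ {n m} → (Fin n → Tm m) → Fin (suc n) → Tm (suc m)
exts σ zero    = var zero
exts σ (suc i) = wkT (σ i)

subT : ∀ {n m} → (Fin n → Tm m) → Tm n → Tm m
subT σ (var i)  = σ i
subT σ `0       = `0
subT σ (`S t)   = `S (subT σ t)
subT σ (s `+ t) = subT σ s `+ subT σ t
subT σ (s `* t) = subT σ s `* subT σ t

sub : ∀ {n m} → (Fin n → Tm m) → Fm n → Fm m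
sub σ (s `≐ t) = subT σ s `≐ subT σ t
sub σ (s `≼ t) = subT σ s `≼ subT σ t
sub σ `⊥       = `⊥
sub σ (φ `⇒ ψ) = sub σ φ `⇒ sub σ ψ
sub σ (φ `∧ ψ) = sub σ φ `∧ sub σ ψ
sub σ (φ `∨ ψ) = sub σ φ `∨ sub σ ψ
sub σ (`∀ φ)   = `∀ (sub (exts σ) φ)
sub σ (`∃ φ)   = `∃ (sub (exts σ) φ)

single : ∀ {n} → Tm n → Fin (suc n) → Tm n
single t zero    = t
single t (suc i) = var i

_[_] : ∀ {n} → Fm (suc n) → Tm n → Fm n
φ [ t ] = sub (single t) φ

infix 0 _⊢_

data _⊢_ {n : ℕ} : List (Fm n) → Fm n → Set where
  hyp   : ∀ {Γ φ} → φ ∈ Γ → Γ ⊢ φ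
  ⇒I    : ∀ {Γ φ ψ} → (φ ∷ Γ) ⊢ ψ → Γ ⊢ φ `⇒ ψ
  ⇒E    : ∀ {Γ φ ψ} → Γ ⊢ φ `⇒ ψ → Γ ⊢ φ → Γ ⊢ ψ
  ∧I    : ∀ {Γ φ ψ} → Γ ⊢ φ → Γ ⊢ ψ → Γ ⊢ φ `∧ ψ
  ∧E₁   : ∀ {Γ φ ψ} → Γ ⊢ φ `∧ ψ → Γ ⊢ φ
  ∧E₂   : ∀ {Γ φ ψ} → Γ ⊢ φ `∧ ψ → Γ ⊢ ψ
  ∨I₁   : ∀ {Γ φ ψ} → Γ ⊢ φ → Γ ⊢ φ `∨ ψ
  ∨I₂   : ∀ {Γ φ ψ} → Γ ⊢ ψ → Γ ⊢ φ `∨ ψ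
  ∨E    : ∀ {Γ φ ψ χ} → Γ ⊢ φ `∨ ψ → (φ ∷ Γ) ⊢ χ → (ψ ∷ Γ) ⊢ χ → Γ ⊢ χ
  raa   : ∀ {Γ φ} → (`¬ φ ∷ Γ) ⊢ `⊥ → Γ ⊢ φ
  ∀I    : ∀ {Γ φ} → map wk Γ ⊢ φ → Γ ⊢ `∀ φ
  ∀E    : ∀ {Γ φ} → Γ ⊢ `∀ φ → (t : Tm n) → Γ ⊢ φ [ t ]
  ∃I    : ∀ {Γ φ} → (t : Tm n) → Γ ⊢ φ [ t ] → Γ ⊢ `∃ φ
  ∃E    : ∀ {Γ φ ψ} → Γ ⊢ `∃ φ → (φ ∷ map wk Γ) ⊢ wk ψ → Γ ⊢ ψ
  ≐refl : ∀ {Γ} (t : Tm n) → Γ ⊢ t `≐ t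
  ≐subst : ∀ {Γ s t} (φ : Fm (suc n)) → Γ ⊢ s `≐ t → Γ ⊢ φ [ s ] → Γ ⊢ φ [ t ]

_⊢ₜ_ : (Fm 0 → Set) → Fm 0 → Set
T ⊢ₜ φ = Σ (List (Fm 0)) λ Γ → All T Γ × (Γ ⊢ φ)

bigOr : ℕ → Fm 1
bigOr zero    = var zero `≐ num 0
bigOr (suc k) = bigOr k `∨ (var zero `≐ num (suc k))

data R0 : Fm 0 → Set where
  ax-add : ∀ m n → R0 (num m `+ num n `≐ num (m + n))
  ax-mul : ∀ m n → R0 (num m `* num n `≐ num (m * n))
  ax-neq : ∀ m n → ¬ (m ≡ n) → R0 (`¬ (num m `≐ num n))
  ax-bd  : ∀ n → R0 (`∀ ((var zero `≼ num n) `⇒ bigOr n))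
  ax-le  : ∀ m n → m ≤ n → R0 (num m `≼ num n)

evalT : ∀ {n} → (Fin n → ℕ) → Tm n → ℕ
evalT e (var i)  = e i
evalT e `0       = 0
evalT e (`S t)   = suc (evalT e t)
evalT e (s `+ t) = evalT e s + evalT e t
evalT e (s `* t) = evalT e s * evalT e t

cons : ∀ {n} → ℕ → (Fin n → ℕ) → Fin (suc n) → ℕ
cons a e zero    = a
cons a e (suc i) = e i

⟦_⟧ : ∀ {n} → Fm n → (Fin n → ℕ) → Set
⟦ s `≐ t ⟧ e = evalT e s ≡ evalT e t
⟦ s `≼ t ⟧ e = evalT e s ≤ evalT e t
⟦ `⊥ ⟧ e     = ⊥
⟦ φ `⇒ ψ ⟧ e = ⟦ φ ⟧ e → ⟦ ψ ⟧ e
⟦ φ `∧ ψ ⟧ e = ⟦ φ ⟧ e × ⟦ ψ ⟧ e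
⟦ φ `∨ ψ ⟧ e = ⟦ φ ⟧ e ⊎ ⟦ ψ ⟧ e
⟦ `∀ φ ⟧ e   = (a : ℕ) → ⟦ φ ⟧ (cons a e)
⟦ `∃ φ ⟧ e   = Σ ℕ λ a → ⟦ φ ⟧ (cons a e)

emptyEnv : Fin 0 → ℕ
emptyEnv ()

ℕ⊨_ : Fm 0 → Set
ℕ⊨ φ = ⟦ φ ⟧ emptyEnv

-- Δ0 (bounded) formulas: bounded quantifiers ∀x≤t, ∀x<t, ∃x≤t, ∃x<t
-- with x not occurring in t

data Δ0 {n : ℕ} : Fm n → Set where
  d≐  : ∀ s t → Δ0 (s `≐ t)
  d≼  : ∀ s t → Δ0 (s `≼ t)
  d⊥  : Δ0 `⊥
  d⇒  : ∀ {φ ψ} → Δ0 φ → Δ0 ψ → Δ0 (φ `⇒ ψ)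
  d∧  : ∀ {φ ψ} → Δ0 φ → Δ0 ψ → Δ0 (φ `∧ ψ)
  d∨  : ∀ {φ ψ} → Δ0 φ → Δ0 ψ → Δ0 (φ `∨ ψ)
  d∀≤ : ∀ t {φ} → Δ0 φ → Δ0 (`∀ ((var zero `≼ wkT t) `⇒ φ))
  d∀< : ∀ t {φ} → Δ0 φ → Δ0 (`∀ ((var zero `< wkT t) `⇒ φ))
  d∃≤ : ∀ t {φ} → Δ0 φ → Δ0 (`∃ ((var zero `≼ wkT t) `∧ φ))
  d∃< : ∀ t {φ} → Δ0 φ → Δ0 (`∃ ((var zero `< wkT t) `∧ φ))

wb : Fm 1
wb = (`0 `≼ var zero) `∧ `∀ ((var zero `< var (suc zero)) `⇒ (`S (var zero) `≼ var (suc zero)))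

-- Witness comparison of 1-Σ1 sentences ∃x φ0(x), ∃y ψ0(y),
-- given by their matrices φ0 ψ0 : Fm 1.

-- view ψ0(y) inside scope (y = var 0, x = var 1)
inner : Fm 1 → Fm 2
inner = ren (λ _ → zero)

_≤W_ : Fm 1 → Fm 1 → Fm 0
φ0 ≤W ψ0 = `∃ (φ0 `∧ `∀ ((var zero `< var (suc zero)) `⇒ `¬ (inner ψ0)))

_<W_ : Fm 1 → Fm 1 → Fm 0
φ0 <W ψ0 = `∃ (φ0 `∧ `∀ ((var zero `≼ var (suc zero)) `⇒ `¬ (inner ψ0)))

-- R0 proves every true and refutes every false Δ0 formula at numerals: numeral arithmetic
-- is axiomatic, and the axiom x ≤ n̄ → ⋁_{i≤n} x = ī reduces a bounded quantifier to its
-- finitely many numeral instances.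
-- Let a witness σ with no witness of σ′ below a (for (b): up to a), and argue in R0 about a
-- witness y of σ′. Every k̄ below a (resp. up to a) differs from y, since R0 refutes σ′(k̄);
-- starting from 0 ≤ y, the clause ∀z<y. S z ≤ y of wb(y) then climbs to ā ≤ y (resp. ā < y).
-- As R0 proves σ₀(ā), this contradicts σ′ < σ (resp. σ′ ≤ σ).
module Submission where

open import Defs
open import Data.Nat using (ℕ; zero; suc; _+_; _*_; _≤_; _<_; z≤n)
open import Data.Nat.Properties
  using (≤-refl; ≤-pred; ≤-<-trans; m≤n⇒m≤1+n; m<n⇒m<1+n; m≤n⇒m<n∨m≡n; <⇒≤; <⇒≢; ≰⇒>; _≟_; _≤?_)
open import Data.Fin using (Fin; zero; suc)
open import Data.List using (List; []; _∷_; map; _++_)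
open import Data.List.Properties using (map-++; map-∘; map-cong; map-id)
open import Data.List.Membership.Propositional using (_∈_)
open import Data.List.Membership.Propositional.Properties using (∈-++⁺ˡ; ∈-++⁺ʳ)
open import Data.List.Relation.Binary.Subset.Propositional using (_⊆_)
open import Data.List.Relation.Binary.Subset.Propositional.Properties
  using (⊆-trans; map⁺; ∷⁺ʳ; ++⁺ʳ; xs⊆x∷xs; xs⊆xs++ys; xs⊆ys++xs)
open import Data.List.Relation.Unary.All using (All; []; _∷_)
open import Data.List.Relation.Unary.All.Properties using (++⁺)
open import Data.List.Relation.Unary.Any using (here; there)
open import Data.Product using (Σ; _×_; _,_; proj₁; proj₂)
import Data.Product as Prod
open import Data.Sum using (_⊎_; inj₁; inj₂; swap; [_,_]′)
import Data.Sum as Sum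
open import Data.Empty using (⊥-elim)
open import Function using (_∘_; id)
open import Function.Bundles using (_⇔_; mk⇔; Equivalence)
open Equivalence using (to; from)
open import Relation.Nullary using (¬_; Dec; yes; no; _×-dec_; ¬?)
open import Relation.Binary.PropositionalEquality using (_≡_; refl; sym; trans; cong; cong₂; subst; subst₂; _≗_; _≢_)

private variable
  n m k : ℕ
  Γ : List (Fm n)
  φ ψ χ : Fm n
  s s′ t t′ u : Tm n

-- Substitution

subT-cong : {σ τ : Fin n → Tm m} → σ ≗ τ → subT σ ≗ subT τ
subT-cong h (var i)  = h i
subT-cong h `0       = refl
subT-cong h (`S t)   = cong `S (subT-cong h t)
subT-cong h (s `+ t) = cong₂ _`+_ (subT-cong h s) (subT-cong h t)
subT-cong h (s `* t) = cong₂ _`*_ (subT-cong h s) (subT-cong h t)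

subT-renT : (σ : Fin m → Tm k) (ρ : Fin n → Fin m) → subT σ ∘ renT ρ ≗ subT (σ ∘ ρ)
subT-renT σ ρ (var i)  = refl
subT-renT σ ρ `0       = refl
subT-renT σ ρ (`S t)   = cong `S (subT-renT σ ρ t)
subT-renT σ ρ (s `+ t) = cong₂ _`+_ (subT-renT σ ρ s) (subT-renT σ ρ t)
subT-renT σ ρ (s `* t) = cong₂ _`*_ (subT-renT σ ρ s) (subT-renT σ ρ t)

renT-subT : (ρ : Fin m → Fin k) (σ : Fin n → Tm m) → renT ρ ∘ subT σ ≗ subT (renT ρ ∘ σ)
renT-subT ρ σ (var i)  = refl
renT-subT ρ σ `0       = refl
renT-subT ρ σ (`S t)   = cong `S (renT-subT ρ σ t)
renT-subT ρ σ (s `+ t) = cong₂ _`+_ (renT-subT ρ σ s) (renT-subT ρ σ t)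
renT-subT ρ σ (s `* t) = cong₂ _`*_ (renT-subT ρ σ s) (renT-subT ρ σ t)

subT-subT : (σ : Fin m → Tm k) (τ : Fin n → Tm m) → subT σ ∘ subT τ ≗ subT (subT σ ∘ τ)
subT-subT σ τ (var i)  = refl
subT-subT σ τ `0       = refl
subT-subT σ τ (`S t)   = cong `S (subT-subT σ τ t)
subT-subT σ τ (s `+ t) = cong₂ _`+_ (subT-subT σ τ s) (subT-subT σ τ t)
subT-subT σ τ (s `* t) = cong₂ _`*_ (subT-subT σ τ s) (subT-subT σ τ t)

subT-id : subT (var {n}) ≗ id
subT-id (var i)  = refl
subT-id `0       = refl
subT-id (`S t)   = cong `S (subT-id t)
subT-id (s `+ t) = cong₂ _`+_ (subT-id s) (subT-id t)
subT-id (s `* t) = cong₂ _`*_ (subT-id s) (subT-id t)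

renT≗subT : (ρ : Fin n → Fin m) → renT ρ ≗ subT (var ∘ ρ)
renT≗subT ρ t = trans (sym (subT-id (renT ρ t))) (subT-renT var ρ t)

subT-single-wkT : (u : Tm n) → subT (single u) ∘ wkT ≗ id
subT-single-wkT u t = trans (subT-renT (single u) suc t) (subT-id t)

subT-num : (σ : Fin n → Tm m) (a : ℕ) → subT σ (num a) ≡ num a
subT-num σ zero    = refl
subT-num σ (suc a) = cong `S (subT-num σ a)

renT-num : (ρ : Fin n → Fin m) (a : ℕ) → renT ρ (num a) ≡ num a
renT-num ρ a = trans (renT≗subT ρ (num a)) (subT-num (var ∘ ρ) a)

exts-cong : {σ τ : Fin n → Tm m} → σ ≗ τ → exts σ ≗ exts τ
exts-cong h zero    = refl
exts-cong h (suc i) = cong wkT (h i)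

exts-subT : (σ : Fin m → Tm k) (τ : Fin n → Tm m) → subT (exts σ) ∘ exts τ ≗ exts (subT σ ∘ τ)
exts-subT σ τ zero    = refl
exts-subT σ τ (suc i) = trans (subT-renT (exts σ) suc (τ i)) (sym (renT-subT suc σ (τ i)))

sub-cong : {σ τ : Fin n → Tm m} → σ ≗ τ → sub σ ≗ sub τ
sub-cong h (s `≐ t) = cong₂ _`≐_ (subT-cong h s) (subT-cong h t)
sub-cong h (s `≼ t) = cong₂ _`≼_ (subT-cong h s) (subT-cong h t)
sub-cong h `⊥       = refl
sub-cong h (φ `⇒ ψ) = cong₂ _`⇒_ (sub-cong h φ) (sub-cong h ψ)
sub-cong h (φ `∧ ψ) = cong₂ _`∧_ (sub-cong h φ) (sub-cong h ψ)
sub-cong h (φ `∨ ψ) = cong₂ _`∨_ (sub-cong h φ) (sub-cong h ψ)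
sub-cong h (`∀ φ)   = cong `∀ (sub-cong (exts-cong h) φ)
sub-cong h (`∃ φ)   = cong `∃ (sub-cong (exts-cong h) φ)

sub-sub : (σ : Fin m → Tm k) (τ : Fin n → Tm m) → sub σ ∘ sub τ ≗ sub (subT σ ∘ τ)
sub-sub σ τ (s `≐ t) = cong₂ _`≐_ (subT-subT σ τ s) (subT-subT σ τ t)
sub-sub σ τ (s `≼ t) = cong₂ _`≼_ (subT-subT σ τ s) (subT-subT σ τ t)
sub-sub σ τ `⊥       = refl
sub-sub σ τ (φ `⇒ ψ) = cong₂ _`⇒_ (sub-sub σ τ φ) (sub-sub σ τ ψ)
sub-sub σ τ (φ `∧ ψ) = cong₂ _`∧_ (sub-sub σ τ φ) (sub-sub σ τ ψ)
sub-sub σ τ (φ `∨ ψ) = cong₂ _`∨_ (sub-sub σ τ φ) (sub-sub σ τ ψ)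
sub-sub σ τ (`∀ φ)   = cong `∀ (trans (sub-sub (exts σ) (exts τ) φ) (sub-cong (exts-subT σ τ) φ))
sub-sub σ τ (`∃ φ)   = cong `∃ (trans (sub-sub (exts σ) (exts τ) φ) (sub-cong (exts-subT σ τ) φ))

exts-var : exts (var {n}) ≗ var
exts-var zero    = refl
exts-var (suc i) = refl

sub-id : sub (var {n}) ≗ id
sub-id (s `≐ t) = cong₂ _`≐_ (subT-id s) (subT-id t)
sub-id (s `≼ t) = cong₂ _`≼_ (subT-id s) (subT-id t)
sub-id `⊥       = refl
sub-id (φ `⇒ ψ) = cong₂ _`⇒_ (sub-id φ) (sub-id ψ)
sub-id (φ `∧ ψ) = cong₂ _`∧_ (sub-id φ) (sub-id ψ)
sub-id (φ `∨ ψ) = cong₂ _`∨_ (sub-id φ) (sub-id ψ)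
sub-id (`∀ φ)   = cong `∀ (trans (sub-cong exts-var φ) (sub-id φ))
sub-id (`∃ φ)   = cong `∃ (trans (sub-cong exts-var φ) (sub-id φ))

ren≗sub : (ρ : Fin n → Fin m) → ren ρ ≗ sub (var ∘ ρ)
ren≗sub ρ (s `≐ t) = cong₂ _`≐_ (renT≗subT ρ s) (renT≗subT ρ t)
ren≗sub ρ (s `≼ t) = cong₂ _`≼_ (renT≗subT ρ s) (renT≗subT ρ t)
ren≗sub ρ `⊥       = refl
ren≗sub ρ (φ `⇒ ψ) = cong₂ _`⇒_ (ren≗sub ρ φ) (ren≗sub ρ ψ)
ren≗sub ρ (φ `∧ ψ) = cong₂ _`∧_ (ren≗sub ρ φ) (ren≗sub ρ ψ)
ren≗sub ρ (φ `∨ ψ) = cong₂ _`∨_ (ren≗sub ρ φ) (ren≗sub ρ ψ)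
ren≗sub ρ (`∀ φ)   = cong `∀ (trans (ren≗sub (ext ρ) φ) (sub-cong var-ext φ))
  where var-ext : var ∘ ext ρ ≗ exts (var ∘ ρ)
        var-ext zero    = refl
        var-ext (suc i) = refl
ren≗sub ρ (`∃ φ)   = cong `∃ (trans (ren≗sub (ext ρ) φ) (sub-cong var-ext φ))
  where var-ext : var ∘ ext ρ ≗ exts (var ∘ ρ)
        var-ext zero    = refl
        var-ext (suc i) = refl

sub-ren : (σ : Fin m → Tm k) (ρ : Fin n → Fin m) → sub σ ∘ ren ρ ≗ sub (σ ∘ ρ)
sub-ren σ ρ φ = trans (cong (sub σ) (ren≗sub ρ φ)) (sub-sub σ (var ∘ ρ) φ)

from-Fin0 : Fin 0 → Fin n
from-Fin0 ()

lift : Fm 0 → Fm n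
lift = ren from-Fin0

sub-sentence : (σ : Fin 0 → Tm n) → sub σ ≗ lift
sub-sentence σ α = trans (sub-cong (λ ()) α) (sym (ren≗sub _ α))

wk-lift : (α : Fm 0) → wk (lift {n} α) ≡ lift α
wk-lift α = trans (ren≗sub suc (lift α)) (trans (sub-ren (var ∘ suc) _ α) (sub-sentence _ α))

lift-num : (a : ℕ) → renT (from-Fin0 {n}) (num a) ≡ num a
lift-num = renT-num from-Fin0

lift-id : (α : Fm 0) → lift α ≡ α
lift-id α = trans (sym (sub-sentence var α)) (sub-id α)

evalT-renT : (ρ : Fin m → Fin n) {e : Fin n → ℕ} {e′ : Fin m → ℕ} →
  e ∘ ρ ≗ e′ → evalT e ∘ renT ρ ≗ evalT e′
evalT-renT ρ h (var i)  = h i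
evalT-renT ρ h `0       = refl
evalT-renT ρ h (`S t)   = cong suc (evalT-renT ρ h t)
evalT-renT ρ h (s `+ t) = cong₂ _+_ (evalT-renT ρ h s) (evalT-renT ρ h t)
evalT-renT ρ h (s `* t) = cong₂ _*_ (evalT-renT ρ h s) (evalT-renT ρ h t)

cons-ext : (ρ : Fin m → Fin n) {e : Fin n → ℕ} {e′ : Fin m → ℕ} →
  e ∘ ρ ≗ e′ → ∀ a → cons a e ∘ ext ρ ≗ cons a e′
cons-ext ρ h a zero    = refl
cons-ext ρ h a (suc i) = h i

⟦ren⟧ : (ρ : Fin m → Fin n) (φ : Fm m) {e : Fin n → ℕ} {e′ : Fin m → ℕ} →
  e ∘ ρ ≗ e′ → ⟦ ren ρ φ ⟧ e ⇔ ⟦ φ ⟧ e′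
⟦ren⟧ ρ (s `≐ t) h = mk⇔ (λ p → trans (sym (evalT-renT ρ h s)) (trans p (evalT-renT ρ h t)))
                         (λ p → trans (evalT-renT ρ h s) (trans p (sym (evalT-renT ρ h t))))
⟦ren⟧ ρ (s `≼ t) h = mk⇔ (subst₂ _≤_ (evalT-renT ρ h s) (evalT-renT ρ h t))
                         (subst₂ _≤_ (sym (evalT-renT ρ h s)) (sym (evalT-renT ρ h t)))
⟦ren⟧ ρ `⊥       h = mk⇔ id id
⟦ren⟧ ρ (φ `⇒ ψ) h = mk⇔ (λ f → to (⟦ren⟧ ρ ψ h) ∘ f ∘ from (⟦ren⟧ ρ φ h))
                         (λ f → from (⟦ren⟧ ρ ψ h) ∘ f ∘ to (⟦ren⟧ ρ φ h))
⟦ren⟧ ρ (φ `∧ ψ) h = mk⇔ (Prod.map (to (⟦ren⟧ ρ φ h)) (to (⟦ren⟧ ρ ψ h)))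
                         (Prod.map (from (⟦ren⟧ ρ φ h)) (from (⟦ren⟧ ρ ψ h)))
⟦ren⟧ ρ (φ `∨ ψ) h = mk⇔ (Sum.map (to (⟦ren⟧ ρ φ h)) (to (⟦ren⟧ ρ ψ h)))
                         (Sum.map (from (⟦ren⟧ ρ φ h)) (from (⟦ren⟧ ρ ψ h)))
⟦ren⟧ ρ (`∀ φ)   h = mk⇔ (λ f a → to (⟦ren⟧ (ext ρ) φ (cons-ext ρ h a)) (f a))
                         (λ f a → from (⟦ren⟧ (ext ρ) φ (cons-ext ρ h a)) (f a))
⟦ren⟧ ρ (`∃ φ)   h = mk⇔ (λ (a , p) → a , to (⟦ren⟧ (ext ρ) φ (cons-ext ρ h a)) p)
                         (λ (a , p) → a , from (⟦ren⟧ (ext ρ) φ (cons-ext ρ h a)) p)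

infix 0 _⊢R_

-- Natural deduction in which the axioms of R0 may be used at any number of free
-- variables; eliminating this rule collects the finitely many axioms used.
data _⊢R_ {n : ℕ} : List (Fm n) → Fm n → Set where
  axm    : ∀ {Γ α} → R0 α → Γ ⊢R lift α
  hyp    : ∀ {Γ φ} → φ ∈ Γ → Γ ⊢R φ
  ⇒I     : ∀ {Γ φ ψ} → (φ ∷ Γ) ⊢R ψ → Γ ⊢R φ `⇒ ψ
  ⇒E     : ∀ {Γ φ ψ} → Γ ⊢R φ `⇒ ψ → Γ ⊢R φ → Γ ⊢R ψ
  ∧I     : ∀ {Γ φ ψ} → Γ ⊢R φ → Γ ⊢R ψ → Γ ⊢R φ `∧ ψ
  ∧E₁    : ∀ {Γ φ ψ} → Γ ⊢R φ `∧ ψ → Γ ⊢R φ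
  ∧E₂    : ∀ {Γ φ ψ} → Γ ⊢R φ `∧ ψ → Γ ⊢R ψ
  ∨I₁    : ∀ {Γ φ ψ} → Γ ⊢R φ → Γ ⊢R φ `∨ ψ
  ∨I₂    : ∀ {Γ φ ψ} → Γ ⊢R ψ → Γ ⊢R φ `∨ ψ
  ∨E     : ∀ {Γ φ ψ χ} → Γ ⊢R φ `∨ ψ → (φ ∷ Γ) ⊢R χ → (ψ ∷ Γ) ⊢R χ → Γ ⊢R χ
  raa    : ∀ {Γ φ} → (`¬ φ ∷ Γ) ⊢R `⊥ → Γ ⊢R φ
  ∀I     : ∀ {Γ φ} → map wk Γ ⊢R φ → Γ ⊢R `∀ φ
  ∀E     : ∀ {Γ φ} → Γ ⊢R `∀ φ → (t : Tm n) → Γ ⊢R φ [ t ]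
  ∃I     : ∀ {Γ φ} → (t : Tm n) → Γ ⊢R φ [ t ] → Γ ⊢R `∃ φ
  ∃E     : ∀ {Γ φ ψ} → Γ ⊢R `∃ φ → (φ ∷ map wk Γ) ⊢R wk ψ → Γ ⊢R ψ
  ≐refl  : ∀ {Γ} (t : Tm n) → Γ ⊢R t `≐ t
  ≐subst : ∀ {Γ s t} (φ : Fm (suc n)) → Γ ⊢R s `≐ t → Γ ⊢R φ [ s ] → Γ ⊢R φ [ t ]

⊢-mono : {Γ Δ : List (Fm n)} {φ : Fm n} → Γ ⊆ Δ → Γ ⊢ φ → Δ ⊢ φ
⊢-mono h (hyp x)        = hyp (h x)
⊢-mono h (⇒I p)         = ⇒I (⊢-mono (∷⁺ʳ _ h) p)
⊢-mono h (⇒E p q)       = ⇒E (⊢-mono h p) (⊢-mono h q)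
⊢-mono h (∧I p q)       = ∧I (⊢-mono h p) (⊢-mono h q)
⊢-mono h (∧E₁ p)        = ∧E₁ (⊢-mono h p)
⊢-mono h (∧E₂ p)        = ∧E₂ (⊢-mono h p)
⊢-mono h (∨I₁ p)        = ∨I₁ (⊢-mono h p)
⊢-mono h (∨I₂ p)        = ∨I₂ (⊢-mono h p)
⊢-mono h (∨E p q r)     = ∨E (⊢-mono h p) (⊢-mono (∷⁺ʳ _ h) q) (⊢-mono (∷⁺ʳ _ h) r)
⊢-mono h (raa p)        = raa (⊢-mono (∷⁺ʳ _ h) p)
⊢-mono h (∀I p)         = ∀I (⊢-mono (map⁺ wk h) p)
⊢-mono h (∀E p t)       = ∀E (⊢-mono h p) t
⊢-mono h (∃I t p)       = ∃I t (⊢-mono h p)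
⊢-mono h (∃E p q)       = ∃E (⊢-mono h p) (⊢-mono (∷⁺ʳ _ (map⁺ wk h)) q)
⊢-mono h (≐refl t)      = ≐refl t
⊢-mono h (≐subst φ p q) = ≐subst φ (⊢-mono h p) (⊢-mono h q)

⊢R-mono : {Γ Δ : List (Fm n)} {φ : Fm n} → Γ ⊆ Δ → Γ ⊢R φ → Δ ⊢R φ
⊢R-mono h (axm r)        = axm r
⊢R-mono h (hyp x)        = hyp (h x)
⊢R-mono h (⇒I p)         = ⇒I (⊢R-mono (∷⁺ʳ _ h) p)
⊢R-mono h (⇒E p q)       = ⇒E (⊢R-mono h p) (⊢R-mono h q)
⊢R-mono h (∧I p q)       = ∧I (⊢R-mono h p) (⊢R-mono h q)
⊢R-mono h (∧E₁ p)        = ∧E₁ (⊢R-mono h p)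
⊢R-mono h (∧E₂ p)        = ∧E₂ (⊢R-mono h p)
⊢R-mono h (∨I₁ p)        = ∨I₁ (⊢R-mono h p)
⊢R-mono h (∨I₂ p)        = ∨I₂ (⊢R-mono h p)
⊢R-mono h (∨E p q r)     = ∨E (⊢R-mono h p) (⊢R-mono (∷⁺ʳ _ h) q) (⊢R-mono (∷⁺ʳ _ h) r)
⊢R-mono h (raa p)        = raa (⊢R-mono (∷⁺ʳ _ h) p)
⊢R-mono h (∀I p)         = ∀I (⊢R-mono (map⁺ wk h) p)
⊢R-mono h (∀E p t)       = ∀E (⊢R-mono h p) t
⊢R-mono h (∃I t p)       = ∃I t (⊢R-mono h p)
⊢R-mono h (∃E p q)       = ∃E (⊢R-mono h p) (⊢R-mono (∷⁺ʳ _ (map⁺ wk h)) q)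
⊢R-mono h (≐refl t)      = ≐refl t
⊢R-mono h (≐subst φ p q) = ≐subst φ (⊢R-mono h p) (⊢R-mono h q)

infix 0 _⊢⟨R0⟩_

_⊢⟨R0⟩_ : List (Fm n) → Fm n → Set
Γ ⊢⟨R0⟩ φ = Σ (List (Fm 0)) λ αs → All R0 αs × (Γ ++ map lift αs ⊢ φ)

with-more-axioms : {Δ : List (Fm n)} {φ : Fm n} {αs βs : List (Fm 0)} →
  αs ⊆ βs → Δ ++ map lift αs ⊢ φ → Δ ++ map lift βs ⊢ φ
with-more-axioms {Δ = Δ} h = ⊢-mono (++⁺ʳ Δ (map⁺ lift h))

map-wk-++-lift : (Γ : List (Fm n)) (αs : List (Fm 0)) → map wk (Γ ++ map lift αs) ≡ map wk Γ ++ map lift αs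
map-wk-++-lift Γ αs =
  trans (map-++ wk Γ (map lift αs)) (cong (map wk Γ ++_) (trans (sym (map-∘ αs)) (map-cong wk-lift αs)))

combine : {n₁ n₂ : ℕ} {Γ₁ : List (Fm n₁)} {Γ₂ : List (Fm n₂)} {Γ : List (Fm n)}
          {φ₁ : Fm n₁} {φ₂ : Fm n₂} {ψ : Fm n} →
  (∀ {αs} → Γ₁ ++ map lift αs ⊢ φ₁ → Γ₂ ++ map lift αs ⊢ φ₂ → Γ ++ map lift αs ⊢ ψ) →
  Γ₁ ⊢⟨R0⟩ φ₁ → Γ₂ ⊢⟨R0⟩ φ₂ → Γ ⊢⟨R0⟩ ψ
combine f (αs , rs , d) (βs , ss , e) =
  αs ++ βs , ++⁺ rs ss , f (with-more-axioms (xs⊆xs++ys αs βs) d) (with-more-axioms (xs⊆ys++xs βs αs) e)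

eliminate-axm : {Γ : List (Fm n)} {φ : Fm n} → Γ ⊢R φ → Γ ⊢⟨R0⟩ φ
eliminate-axm {Γ = Γ} (axm {α = α} r) = α ∷ [] , r ∷ [] , hyp (∈-++⁺ʳ Γ (here refl))
eliminate-axm (hyp x)        = [] , [] , hyp (∈-++⁺ˡ x)
eliminate-axm (⇒I p)         = Prod.map₂ (Prod.map₂ ⇒I) (eliminate-axm p)
eliminate-axm (⇒E p q)       = combine ⇒E (eliminate-axm p) (eliminate-axm q)
eliminate-axm (∧I p q)       = combine ∧I (eliminate-axm p) (eliminate-axm q)
eliminate-axm (∧E₁ p)        = Prod.map₂ (Prod.map₂ ∧E₁) (eliminate-axm p)
eliminate-axm (∧E₂ p)        = Prod.map₂ (Prod.map₂ ∧E₂) (eliminate-axm p)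
eliminate-axm (∨I₁ p)        = Prod.map₂ (Prod.map₂ ∨I₁) (eliminate-axm p)
eliminate-axm (∨I₂ p)        = Prod.map₂ (Prod.map₂ ∨I₂) (eliminate-axm p)
eliminate-axm (∨E p q r)     with eliminate-axm p | eliminate-axm q | eliminate-axm r
... | αs , rs , d | βs , ss , e | γs , ts , f =
  αs ++ βs ++ γs , ++⁺ rs (++⁺ ss ts) ,
  ∨E (with-more-axioms (xs⊆xs++ys αs _) d)
     (with-more-axioms (⊆-trans (xs⊆xs++ys βs γs) (xs⊆ys++xs _ αs)) e)
     (with-more-axioms (⊆-trans (xs⊆ys++xs γs βs) (xs⊆ys++xs _ αs)) f)
eliminate-axm (raa p)        = Prod.map₂ (Prod.map₂ raa) (eliminate-axm p)
eliminate-axm {Γ = Γ} (∀I p) with eliminate-axm p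
... | αs , rs , d = αs , rs , ∀I (subst (_⊢ _) (sym (map-wk-++-lift Γ αs)) d)
eliminate-axm (∀E p t)       = Prod.map₂ (Prod.map₂ (λ d → ∀E d t)) (eliminate-axm p)
eliminate-axm (∃I t p)       = Prod.map₂ (Prod.map₂ (∃I t)) (eliminate-axm p)
eliminate-axm {Γ = Γ} (∃E {φ = φ} {ψ = ψ} p q) =
  combine (λ {αs} d e → ∃E d (subst (λ Δ → φ ∷ Δ ⊢ wk ψ) (sym (map-wk-++-lift Γ αs)) e))
          (eliminate-axm p) (eliminate-axm q)
eliminate-axm (≐refl t)      = [] , [] , ≐refl t
eliminate-axm (≐subst φ p q) = combine (≐subst φ) (eliminate-axm p) (eliminate-axm q)

⊢R-sound : {φ : Fm 0} → [] ⊢R φ → R0 ⊢ₜ φ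
⊢R-sound p with eliminate-axm p
... | αs , rs , d = αs , rs , subst (_⊢ _) (trans (map-cong lift-id αs) (map-id αs)) d

hyp₀ : (φ ∷ Γ) ⊢R φ
hyp₀ = hyp (here refl)

weaken : Γ ⊢R φ → (ψ ∷ Γ) ⊢R φ
weaken = ⊢R-mono (xs⊆x∷xs _ _)

cut : Γ ⊢R φ → (φ ∷ Γ) ⊢R ψ → Γ ⊢R ψ
cut p q = ⇒E (⇒I q) p

⊥E : Γ ⊢R `⊥ → Γ ⊢R φ
⊥E p = raa (weaken p)

cast : φ ≡ ψ → Γ ⊢R φ → Γ ⊢R ψ
cast refl p = p

≐-transport : {A B : Fm n} (φ : Fm (suc n)) →
  Γ ⊢R s `≐ t → φ [ s ] ≡ A → φ [ t ] ≡ B → Γ ⊢R A → Γ ⊢R B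
≐-transport φ p refl refl = ≐subst φ p

≐-sym : Γ ⊢R s `≐ t → Γ ⊢R t `≐ s
≐-sym {s = s} {t} p =
  ≐-transport (var zero `≐ wkT s) p
    (cong (s `≐_) (subT-single-wkT s s)) (cong (t `≐_) (subT-single-wkT t s)) (≐refl s)

≐-trans : Γ ⊢R s `≐ t → Γ ⊢R t `≐ u → Γ ⊢R s `≐ u
≐-trans {s = s} {t} {u} p q =
  ≐-transport (wkT s `≐ var zero) q
    (cong (_`≐ t) (subT-single-wkT t s)) (cong (_`≐ u) (subT-single-wkT u s)) p

≐-cong : (c : Tm (suc n)) → Γ ⊢R s `≐ t → Γ ⊢R subT (single s) c `≐ subT (single t) c
≐-cong {s = s} {t} c p =
  ≐-transport (wkT (subT (single s) c) `≐ c) p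
    (cong (_`≐ subT (single s) c) (subT-single-wkT s _))
    (cong (_`≐ subT (single t) c) (subT-single-wkT t _)) (≐refl _)

≐-cong-+ : Γ ⊢R s `≐ s′ → Γ ⊢R t `≐ t′ → Γ ⊢R s `+ t `≐ s′ `+ t′
≐-cong-+ {Γ = Γ} {s = s} {s′} {t} {t′} p q = ≐-trans
  (subst₂ (λ a b → Γ ⊢R s `+ a `≐ s′ `+ b) (subT-single-wkT s t) (subT-single-wkT s′ t)
    (≐-cong (var zero `+ wkT t) p))
  (subst₂ (λ a b → Γ ⊢R a `+ t `≐ b `+ t′) (subT-single-wkT t s′) (subT-single-wkT t′ s′)
    (≐-cong (wkT s′ `+ var zero) q))

≐-cong-* : Γ ⊢R s `≐ s′ → Γ ⊢R t `≐ t′ → Γ ⊢R s `* t `≐ s′ `* t′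
≐-cong-* {Γ = Γ} {s = s} {s′} {t} {t′} p q = ≐-trans
  (subst₂ (λ a b → Γ ⊢R s `* a `≐ s′ `* b) (subT-single-wkT s t) (subT-single-wkT s′ t)
    (≐-cong (var zero `* wkT t) p))
  (subst₂ (λ a b → Γ ⊢R a `* t `≐ b `* t′) (subT-single-wkT t s′) (subT-single-wkT t′ s′)
    (≐-cong (wkT s′ `* var zero) q))

≼-resp-≐ : Γ ⊢R s `≐ s′ → Γ ⊢R t `≐ t′ → Γ ⊢R s `≼ t → Γ ⊢R s′ `≼ t′
≼-resp-≐ {s = s} {s′} {t} {t′} p q r =
  ≐-transport (wkT s′ `≼ var zero) q
    (cong (_`≼ t) (subT-single-wkT t s′)) (cong (_`≼ t′) (subT-single-wkT t′ s′))
    (≐-transport (var zero `≼ wkT t) p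
      (cong (s `≼_) (subT-single-wkT s t)) (cong (s′ `≼_) (subT-single-wkT s′ t)) r)

R0-add : ∀ a b → Γ ⊢R num a `+ num b `≐ num (a + b)
R0-add a b = cast (cong₂ _`≐_ (cong₂ _`+_ (lift-num a) (lift-num b)) (lift-num (a + b))) (axm (ax-add a b))

R0-mul : ∀ a b → Γ ⊢R num a `* num b `≐ num (a * b)
R0-mul a b = cast (cong₂ _`≐_ (cong₂ _`*_ (lift-num a) (lift-num b)) (lift-num (a * b))) (axm (ax-mul a b))

R0-≢ : ∀ {a b} → a ≢ b → Γ ⊢R `¬ (num a `≐ num b)
R0-≢ {a = a} {b} a≢b = cast (cong `¬ (cong₂ _`≐_ (lift-num a) (lift-num b))) (axm (ax-neq a b a≢b))

R0-≤ : ∀ {a b} → a ≤ b → Γ ⊢R num a `≼ num b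
R0-≤ {a = a} {b} a≤b = cast (cong₂ _`≼_ (lift-num a) (lift-num b)) (axm (ax-le a b a≤b))

numeralCases : Tm n → ℕ → Fm n
numeralCases u zero    = u `≐ num 0
numeralCases u (suc b) = numeralCases u b `∨ (u `≐ num (suc b))

sub-bigOr : (σ : Fin 1 → Tm n) (b : ℕ) → sub σ (bigOr b) ≡ numeralCases (σ zero) b
sub-bigOr σ zero    = refl
sub-bigOr σ (suc b) = cong₂ _`∨_ (sub-bigOr σ b) (cong (σ zero `≐_) (subT-num σ (suc b)))

R0-bounded : ∀ b → Γ ⊢R u `≼ num b → Γ ⊢R numeralCases u b
R0-bounded {u = u} b = ⇒E (cast instance≡ (∀E (axm (ax-bd b)) u))
  where
    instance≡ : sub (single u) (ren (ext from-Fin0) ((var zero `≼ num b) `⇒ bigOr b))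
              ≡ ((u `≼ num b) `⇒ numeralCases u b)
    instance≡ = trans (sub-ren (single u) (ext from-Fin0) ((var zero `≼ num b) `⇒ bigOr b))
      (cong₂ (λ c φ → (u `≼ c) `⇒ φ) (subT-num (single u ∘ ext from-Fin0) b)
                                      (sub-bigOr (single u ∘ ext from-Fin0) b))

numeralCases-elim : ∀ b → Γ ⊢R numeralCases u b →
  (∀ i → i ≤ b → ((u `≐ num i) ∷ Γ) ⊢R χ) → Γ ⊢R χ
numeralCases-elim zero    p cases = cut p (cases zero z≤n)
numeralCases-elim (suc b) p cases =
  ∨E p (numeralCases-elim b hyp₀
         λ i i≤b → ⊢R-mono (∷⁺ʳ _ (xs⊆x∷xs _ _)) (cases i (m≤n⇒m≤1+n i≤b)))
       (cases (suc b) ≤-refl)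

R0-≼-cases : ∀ b → Γ ⊢R u `≼ num b → (∀ i → i ≤ b → ((u `≐ num i) ∷ Γ) ⊢R χ) → Γ ⊢R χ
R0-≼-cases b p = numeralCases-elim b (R0-bounded b p)

R0-≰ : ∀ {a b} → b < a → Γ ⊢R num a `≼ num b → Γ ⊢R `⊥
R0-≰ {b = b} b<a p =
  R0-≼-cases b p λ i i≤b → ⇒E (R0-≢ (λ a≡i → <⇒≢ (≤-<-trans i≤b b<a) (sym a≡i))) hyp₀

nums : (Fin m → ℕ) → Fin m → Tm n
nums e i = num (e i)

R0-eval : (e : Fin m → ℕ) (t : Tm m) → Γ ⊢R subT (nums e) t `≐ num (evalT e t)
R0-eval e (var i)  = ≐refl _
R0-eval e `0       = ≐refl _
R0-eval e (`S t)   = ≐-cong (`S (var zero)) (R0-eval e t)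
R0-eval e (s `+ t) = ≐-trans (≐-cong-+ (R0-eval e s) (R0-eval e t)) (R0-add _ _)
R0-eval e (s `* t) = ≐-trans (≐-cong-* (R0-eval e s) (R0-eval e t)) (R0-mul _ _)

data Guard : Set where
  ≤ᵍ <ᵍ : Guard

guard : Guard → Tm n → Tm n → Fm n
guard ≤ᵍ u s = u `≼ s
guard <ᵍ u s = u `< s

Guarded : Guard → ℕ → ℕ → Set
Guarded ≤ᵍ a b = a ≤ b
Guarded <ᵍ a b = a ≤ b × a ≢ b

dual : Guard → Guard
dual ≤ᵍ = <ᵍ
dual <ᵍ = ≤ᵍ

Bounded∀ Bounded∃ : Guard → Tm m → Fm (suc m) → Fm m
Bounded∀ g t φ = `∀ (guard g (var zero) (wkT t) `⇒ φ)
Bounded∃ g t φ = `∃ (guard g (var zero) (wkT t) `∧ φ)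

sub-guard : ∀ g (σ : Fin n → Tm m) u s → sub σ (guard g u s) ≡ guard g (subT σ u) (subT σ s)
sub-guard ≤ᵍ σ u s = refl
sub-guard <ᵍ σ u s = refl

⟦guard⟧ : ∀ g (u s : Tm n) e → ⟦ guard g u s ⟧ e ≡ Guarded g (evalT e u) (evalT e s)
⟦guard⟧ ≤ᵍ u s e = refl
⟦guard⟧ <ᵍ u s e = refl

Guarded⇒≤ : ∀ g {a b} → Guarded g a b → a ≤ b
Guarded⇒≤ ≤ᵍ a≤b       = a≤b
Guarded⇒≤ <ᵍ (a≤b , _) = a≤b

Guarded? : ∀ g a b → Dec (Guarded g a b)
Guarded? ≤ᵍ a b = a ≤? b
Guarded? <ᵍ a b = a ≤? b ×-dec ¬? (a ≟ b)

guard-intro : ∀ g {a b} → Guarded g a b → Γ ⊢R s `≐ num b → Γ ⊢R guard g (num a) s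
guard-intro ≤ᵍ a≤b         s≐b = ≼-resp-≐ (≐refl _) (≐-sym s≐b) (R0-≤ a≤b)
guard-intro <ᵍ (a≤b , a≢b) s≐b =
  ∧I (guard-intro ≤ᵍ a≤b s≐b) (⇒I (⇒E (R0-≢ a≢b) (≐-trans hyp₀ (weaken s≐b))))

guard-elim : ∀ g {b} → Γ ⊢R guard g u s → Γ ⊢R s `≐ num b →
  (∀ i → Guarded g i b → ((u `≐ num i) ∷ Γ) ⊢R χ) → Γ ⊢R χ
guard-elim ≤ᵍ {b} p s≐b cases = R0-≼-cases b (≼-resp-≐ (≐refl _) s≐b p) cases
guard-elim <ᵍ {b} p s≐b cases = guard-elim ≤ᵍ (∧E₁ p) s≐b case≤
  where
    case≤ : ∀ i → i ≤ b → _
    case≤ i i≤b with i ≟ b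
    ... | no i≢b  = cases i (i≤b , i≢b)
    ... | yes refl = ⊥E (⇒E (weaken (∧E₂ p)) (≐-trans hyp₀ (≐-sym (weaken s≐b))))

sub-nums-cons : (e : Fin m → ℕ) (a : ℕ) (φ : Fm (suc m)) →
  sub (exts (nums {n = n} e)) φ [ num a ] ≡ sub (nums (cons a e)) φ
sub-nums-cons e a φ = trans (sub-sub (single (num a)) (exts (nums e)) φ) (sub-cong pointwise φ)
  where
    pointwise : subT (single (num a)) ∘ exts (nums e) ≗ nums (cons a e)
    pointwise zero    = refl
    pointwise (suc j) = subT-single-wkT (num a) (num (e j))

sub-nums-var : (e : Fin m → ℕ) (φ : Fm (suc m)) →
  sub (exts (nums {n = suc n} e)) φ [ var zero ] ≡ sub (exts (nums e)) φ
sub-nums-var e φ = trans (sub-sub (single (var zero)) (exts (nums e)) φ) (sub-cong pointwise φ)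
  where
    pointwise : subT (single (var zero)) ∘ exts (nums e) ≗ exts (nums e)
    pointwise zero    = refl
    pointwise (suc j) = trans (subT-single-wkT (var zero) (num (e j))) (sym (renT-num suc (e j)))

at-numeral : {Γ : List (Fm (suc n))} (e : Fin m → ℕ) (φ : Fm (suc m)) →
  Γ ⊢R var zero `≐ num k → Γ ⊢R sub (exts (nums e)) φ → Γ ⊢R sub (nums (cons k e)) φ
at-numeral e φ p = ≐-transport (sub (exts (nums e)) φ) p (sub-nums-var e φ) (sub-nums-cons e _ φ)

from-numeral : {Γ : List (Fm (suc n))} (e : Fin m → ℕ) (φ : Fm (suc m)) →
  Γ ⊢R num k `≐ var zero → Γ ⊢R sub (nums (cons k e)) φ → Γ ⊢R sub (exts (nums e)) φ
from-numeral e φ p = ≐-transport (sub (exts (nums e)) φ) p (sub-nums-cons e _ φ) (sub-nums-var e φ)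

sub-bound : ∀ g (e : Fin m → ℕ) t →
  sub (exts (nums {n = n} e)) (guard g (var zero) (wkT t)) ≡ guard g (var zero) (subT (nums e) t)
sub-bound g e t = trans (sub-guard g (exts (nums e)) (var zero) (wkT t))
  (cong (guard g (var zero)) (trans (subT-renT (exts (nums e)) suc t) (subT-cong (λ i → renT-num suc (e i)) t)))

sub-bound-at : ∀ g (e : Fin m → ℕ) a t →
  sub (exts (nums {n = n} e)) (guard g (var zero) (wkT t)) [ num a ] ≡ guard g (num a) (subT (nums e) t)
sub-bound-at g e a t = trans (sub-nums-cons e a (guard g (var zero) (wkT t)))
  (trans (sub-guard g (nums (cons a e)) (var zero) (wkT t)) (cong (guard g (num a)) (subT-renT (nums (cons a e)) suc t)))

⟦bound⟧ : ∀ g (t : Tm m) e a → ⟦ guard g (var zero) (wkT t) ⟧ (cons a e) ≡ Guarded g a (evalT e t)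
⟦bound⟧ g t e a =
  trans (⟦guard⟧ g (var zero) (wkT t) (cons a e)) (cong (Guarded g a) (evalT-renT suc (λ _ → refl) t))

-- Δ0 completeness of R0

R0-Proves R0-Refutes R0-Decides : Fm m → (Fin m → ℕ) → Set
R0-Proves  φ e = ∀ {n} {Γ : List (Fm n)} → Γ ⊢R sub (nums e) φ
R0-Refutes φ e = ∀ {n} {Γ : List (Fm n)} → Γ ⊢R `¬ (sub (nums e) φ)
R0-Decides φ e = (⟦ φ ⟧ e × R0-Proves φ e) ⊎ (¬ ⟦ φ ⟧ e × R0-Refutes φ e)

bounded-search : {A B : ℕ → Set} → (∀ a → A a ⊎ B a) →
  ∀ b → (∀ a → a ≤ b → A a) ⊎ Σ ℕ λ a → a ≤ b × B a
bounded-search f zero with f zero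
... | inj₁ x = inj₁ λ { zero z≤n → x }
... | inj₂ y = inj₂ (zero , z≤n , y)
bounded-search {A = A} f (suc b) with bounded-search f b | f (suc b)
... | inj₂ (a , a≤b , y) | _      = inj₂ (a , m≤n⇒m≤1+n a≤b , y)
... | inj₁ _             | inj₂ y = inj₂ (suc b , ≤-refl , y)
... | inj₁ below         | inj₁ x =
  inj₁ λ a a≤1+b → [ below a ∘ ≤-pred , (λ a≡1+b → subst A (sym a≡1+b) x) ]′ (m≤n⇒m<n∨m≡n a≤1+b)

restrict : {P X Y : Set} → Dec P → X ⊎ Y → (P → X) ⊎ (P × Y)
restrict (no ¬p) _        = inj₁ λ p → ⊥-elim (¬p p)
restrict (yes _) (inj₁ x) = inj₁ λ _ → x
restrict (yes p) (inj₂ y) = inj₂ (p , y)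

module _ (g : Guard) (t : Tm m) {φ : Fm (suc m)} (e : Fin m → ℕ) where

  bounded-∀-holds : (∀ a → Guarded g a (evalT e t) → ⟦ φ ⟧ (cons a e) × R0-Proves φ (cons a e)) →
    ⟦ Bounded∀ g t φ ⟧ e × R0-Proves (Bounded∀ g t φ) e
  bounded-∀-holds holds =
    (λ a ga → proj₁ (holds a (subst id (⟦bound⟧ g t e a) ga))) ,
    ∀I (⇒I (guard-elim g (cast (sub-bound g e t) hyp₀) (R0-eval e t)
              λ i gi → from-numeral e φ (≐-sym hyp₀) (proj₂ (holds i gi))))

  bounded-∀-fails : ∀ a → Guarded g a (evalT e t) → ¬ ⟦ φ ⟧ (cons a e) → R0-Refutes φ (cons a e) →
    ¬ ⟦ Bounded∀ g t φ ⟧ e × R0-Refutes (Bounded∀ g t φ) e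
  bounded-∀-fails a ga ¬φa refutes =
    (λ f → ¬φa (f a (subst id (sym (⟦bound⟧ g t e a)) ga))) ,
    ⇒I (⇒E refutes (⇒E (cast (cong₂ _`⇒_ (sub-bound-at g e a t) (sub-nums-cons e a φ))
                              (∀E hyp₀ (num a)))
                        (guard-intro g ga (R0-eval e t))))

  bounded-∃-holds : ∀ a → Guarded g a (evalT e t) → ⟦ φ ⟧ (cons a e) → R0-Proves φ (cons a e) →
    ⟦ Bounded∃ g t φ ⟧ e × R0-Proves (Bounded∃ g t φ) e
  bounded-∃-holds a ga φa proves =
    (a , subst id (sym (⟦bound⟧ g t e a)) ga , φa) ,
    ∃I (num a) (cast (sym (cong₂ _`∧_ (sub-bound-at g e a t) (sub-nums-cons e a φ)))
                     (∧I (guard-intro g ga (R0-eval e t)) proves))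

  bounded-∃-fails : (∀ a → Guarded g a (evalT e t) → ¬ ⟦ φ ⟧ (cons a e) × R0-Refutes φ (cons a e)) →
    ¬ ⟦ Bounded∃ g t φ ⟧ e × R0-Refutes (Bounded∃ g t φ) e
  bounded-∃-fails none =
    (λ (a , ga , φa) → proj₁ (none a (subst id (⟦bound⟧ g t e a) ga)) φa) ,
    ⇒I (∃E hyp₀
         (guard-elim g (cast (sub-bound g e t) (∧E₁ hyp₀)) (R0-eval e t)
            λ i gi → ⇒E (proj₂ (none i gi)) (at-numeral e φ hyp₀ (∧E₂ (hyp (there (here refl)))))))

  bounded-∀ : (∀ a → R0-Decides φ (cons a e)) → R0-Decides (Bounded∀ g t φ) e
  bounded-∀ decide with bounded-search (λ a → restrict (Guarded? g a (evalT e t)) (decide a)) (evalT e t)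
  ... | inj₁ all                            = inj₁ (bounded-∀-holds λ a ga → all a (Guarded⇒≤ g ga) ga)
  ... | inj₂ (a , _ , ga , ¬φa , refutes) = inj₂ (bounded-∀-fails a ga ¬φa refutes)

  bounded-∃ : (∀ a → R0-Decides φ (cons a e)) → R0-Decides (Bounded∃ g t φ) e
  bounded-∃ decide with bounded-search (λ a → restrict (Guarded? g a (evalT e t)) (swap (decide a))) (evalT e t)
  ... | inj₁ none                         = inj₂ (bounded-∃-fails λ a ga → none a (Guarded⇒≤ g ga) ga)
  ... | inj₂ (a , _ , ga , φa , proves) = inj₁ (bounded-∃-holds a ga φa proves)

Δ0-decided : {φ : Fm m} → Δ0 φ → (e : Fin m → ℕ) → R0-Decides φ e
Δ0-decided (d≐ s t) e with evalT e s ≟ evalT e t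
... | yes s≡t =
  inj₁ (s≡t , ≐-trans (R0-eval e s) (≐-sym (cast (cong (λ c → _ `≐ num c) (sym s≡t)) (R0-eval e t))))
... | no s≢t  =
  inj₂ (s≢t , ⇒I (⇒E (R0-≢ s≢t) (≐-trans (≐-trans (≐-sym (R0-eval e s)) hyp₀) (R0-eval e t))))
Δ0-decided (d≼ s t) e with evalT e s ≤? evalT e t
... | yes s≤t = inj₁ (s≤t , ≼-resp-≐ (≐-sym (R0-eval e s)) (≐-sym (R0-eval e t)) (R0-≤ s≤t))
... | no s≰t  = inj₂ (s≰t , ⇒I (R0-≰ (≰⇒> s≰t) (≼-resp-≐ (R0-eval e s) (R0-eval e t) hyp₀)))
Δ0-decided d⊥ e = inj₂ (id , ⇒I hyp₀)
Δ0-decided (d⇒ dφ dψ) e with Δ0-decided dφ e | Δ0-decided dψ e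
... | _              | inj₁ (ψ✓ , ⊢ψ) = inj₁ ((λ _ → ψ✓) , ⇒I (weaken ⊢ψ))
... | inj₂ (¬φ , ⊢¬φ) | _             = inj₁ ((⊥-elim ∘ ¬φ) , ⇒I (⊥E (⇒E ⊢¬φ hyp₀)))
... | inj₁ (φ✓ , ⊢φ) | inj₂ (¬ψ , ⊢¬ψ) =
  inj₂ ((λ f → ¬ψ (f φ✓)) , ⇒I (⇒E ⊢¬ψ (⇒E hyp₀ ⊢φ)))
Δ0-decided (d∧ dφ dψ) e with Δ0-decided dφ e | Δ0-decided dψ e
... | inj₁ (φ✓ , ⊢φ) | inj₁ (ψ✓ , ⊢ψ) = inj₁ ((φ✓ , ψ✓) , ∧I ⊢φ ⊢ψ)
... | inj₂ (¬φ , ⊢¬φ) | _             = inj₂ ((¬φ ∘ proj₁) , ⇒I (⇒E ⊢¬φ (∧E₁ hyp₀)))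
... | inj₁ _         | inj₂ (¬ψ , ⊢¬ψ) = inj₂ ((¬ψ ∘ proj₂) , ⇒I (⇒E ⊢¬ψ (∧E₂ hyp₀)))
Δ0-decided (d∨ dφ dψ) e with Δ0-decided dφ e | Δ0-decided dψ e
... | inj₁ (φ✓ , ⊢φ) | _             = inj₁ (inj₁ φ✓ , ∨I₁ ⊢φ)
... | inj₂ _         | inj₁ (ψ✓ , ⊢ψ) = inj₁ (inj₂ ψ✓ , ∨I₂ ⊢ψ)
... | inj₂ (¬φ , ⊢¬φ) | inj₂ (¬ψ , ⊢¬ψ) =
  inj₂ ([ ¬φ , ¬ψ ]′ , ⇒I (∨E hyp₀ (⇒E ⊢¬φ hyp₀) (⇒E ⊢¬ψ hyp₀)))
Δ0-decided (d∀≤ t d) e = bounded-∀ ≤ᵍ t e λ a → Δ0-decided d (cons a e)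
Δ0-decided (d∀< t d) e = bounded-∀ <ᵍ t e λ a → Δ0-decided d (cons a e)
Δ0-decided (d∃≤ t d) e = bounded-∃ ≤ᵍ t e λ a → Δ0-decided d (cons a e)
Δ0-decided (d∃< t d) e = bounded-∃ <ᵍ t e λ a → Δ0-decided d (cons a e)

Δ0-provable : {φ : Fm m} → Δ0 φ → (e : Fin m → ℕ) → ⟦ φ ⟧ e → R0-Proves φ e
Δ0-provable dφ e φ✓ with Δ0-decided dφ e
... | inj₁ (_ , ⊢φ) = ⊢φ
... | inj₂ (¬φ , _) = ⊥-elim (¬φ φ✓)

Δ0-refutable : {φ : Fm m} → Δ0 φ → (e : Fin m → ℕ) → ¬ ⟦ φ ⟧ e → R0-Refutes φ e
Δ0-refutable dφ e ¬φ with Δ0-decided dφ e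
... | inj₂ (_ , ⊢¬φ) = ⊢¬φ
... | inj₁ (φ✓ , _)  = ⊥-elim (¬φ φ✓)

-- Witness comparison

Δ0-wb : Δ0 wb
Δ0-wb = d∧ (d≼ `0 (var zero)) (d∀< (var zero) (d≼ (`S (var zero)) (var (suc zero))))

wb-climb : {Γ : List (Fm 1)} → Γ ⊢R wb →
  ∀ a → (∀ k → k < a → Γ ⊢R `¬ (num k `≐ var zero)) → Γ ⊢R num a `≼ var zero
wb-climb w zero    _  = ∧E₁ w
wb-climb w (suc a) ≢y =
  ⇒E (∀E (∧E₂ w) (num a)) (∧I (wb-climb w a λ k k<a → ≢y k (m<n⇒m<1+n k<a)) (≢y a ≤-refl))

wb-above : {Γ : List (Fm 1)} → Γ ⊢R wb →
  ∀ g a → (∀ k → Guarded (dual g) k a → Γ ⊢R `¬ (num k `≐ var zero)) →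
  Γ ⊢R guard g (num a) (var zero)
wb-above w ≤ᵍ a ≢y = wb-climb w a λ k k<a → ≢y k (<⇒≤ k<a , <⇒≢ k<a)
wb-above w <ᵍ a ≢y = ∧I (wb-climb w a λ k k<a → ≢y k (<⇒≤ k<a)) (≢y a ≤-refl)

inner-[] : (φ : Fm 1) (u : Tm 1) → inner φ [ u ] ≡ sub (λ _ → u) φ
inner-[] φ u = sub-ren (single u) (λ _ → zero) φ

inner-var : (φ : Fm 1) → inner φ [ var zero ] ≡ φ
inner-var φ = trans (inner-[] φ (var zero)) (trans (sub-cong (λ { zero → refl }) φ) (sub-id φ))

inner-num : (φ : Fm 1) (a : ℕ) → inner φ [ num a ] ≡ sub (nums (cons a emptyEnv)) φ
inner-num φ a = trans (inner-[] φ (num a)) (sub-cong (λ { zero → refl }) φ)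

⟦inner⟧ : (φ : Fm 1) (k a : ℕ) → ⟦ φ ⟧ (cons k emptyEnv) → ⟦ inner φ ⟧ (cons k (cons a emptyEnv))
⟦inner⟧ φ k a = from (⟦ren⟧ (λ _ → zero) φ λ { zero → refl })

≢-refuted : {Γ : List (Fm 1)} {φ : Fm 1} →
  R0-Refutes φ (cons k emptyEnv) → Γ ⊢R φ → Γ ⊢R `¬ (num k `≐ var zero)
≢-refuted {φ = φ} ⊢¬φk ⊢φ =
  ⇒I (⇒E ⊢¬φk (≐-transport (inner φ) (≐-sym hyp₀) (inner-var φ) (inner-num φ _) (weaken ⊢φ)))

refute-later-witness : ∀ g a {σ₀ σ₀′ : Fm 1} {Γ : List (Fm 1)} →
  R0-Proves σ₀ (cons a emptyEnv) →
  (∀ k → Guarded (dual g) k a → R0-Refutes (wb `∧ σ₀′) (cons k emptyEnv)) →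
  Γ ⊢R wb `∧ σ₀′ → Γ ⊢R `∀ (guard g (var zero) (var (suc zero)) `⇒ `¬ (inner σ₀)) → Γ ⊢R `⊥
refute-later-witness g a {σ₀} {Γ = Γ} ⊢σ₀a ⊢¬σ′k ⊢σ′y ⊢¬σ₀-before-y =
  ⇒E (⇒E ⊢¬σ₀a-if-before (wb-above (∧E₁ ⊢σ′y) g a ≢y)) ⊢σ₀a
  where
    ⊢¬σ₀a-if-before : Γ ⊢R guard g (num a) (var zero) `⇒ `¬ (sub (nums (cons a emptyEnv)) σ₀)
    ⊢¬σ₀a-if-before = cast (cong₂ _`⇒_ (sub-guard g _ (var zero) (var (suc zero))) (cong `¬ (inner-num σ₀ a)))
                           (∀E ⊢¬σ₀-before-y (num a))
    ≢y : ∀ k → Guarded (dual g) k a → Γ ⊢R `¬ (num k `≐ var zero)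
    ≢y k gk = ≢-refuted (⊢¬σ′k k gk) ⊢σ′y

-- Compare <ᵍ and Compare ≤ᵍ are definitionally _≤W_ and _<W_.
Compare : Guard → Fm 1 → Fm 1 → Fm 0
Compare g φ₀ ψ₀ = `∃ (φ₀ `∧ `∀ (guard g (var zero) (var (suc zero)) `⇒ `¬ (inner ψ₀)))

compare-refuted : ∀ g (σ₀ σ₀′ : Fm 1) → Δ0 σ₀ → Δ0 σ₀′ →
  ℕ⊨ Compare (dual g) σ₀ (wb `∧ σ₀′) → R0 ⊢ₜ `¬ (Compare g (wb `∧ σ₀′) σ₀)
compare-refuted g σ₀ σ₀′ Δ0σ₀ Δ0σ₀′ (a , σ₀a , no-earlier) =
  ⊢R-sound (⇒I (∃E hyp₀ (refute-later-witness g a (Δ0-provable Δ0σ₀ _ σ₀a) ⊢¬σ′k (∧E₁ hyp₀) (∧E₂ hyp₀))))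
  where
    ⊢¬σ′k : ∀ k → Guarded (dual g) k a → R0-Refutes (wb `∧ σ₀′) (cons k emptyEnv)
    ⊢¬σ′k k gk = Δ0-refutable (d∧ Δ0-wb Δ0σ₀′) _
      (no-earlier k (subst id (sym (⟦guard⟧ (dual g) (var zero) (var (suc zero)) _)) gk)
         ∘ ⟦inner⟧ (wb `∧ σ₀′) k a)

lemma6p3 : (σ₀ σ₀′ : Fm 1) → Δ0 σ₀ → Δ0 σ₀′ →
    ((ℕ⊨ (σ₀ ≤W (wb `∧ σ₀′)) → R0 ⊢ₜ `¬ ((wb `∧ σ₀′) <W σ₀))
     × (ℕ⊨ (σ₀ <W (wb `∧ σ₀′)) → R0 ⊢ₜ `¬ ((wb `∧ σ₀′) ≤W σ₀)))
lemma6p3 σ₀ σ₀′ Δ0σ₀ Δ0σ₀′ =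
  compare-refuted ≤ᵍ σ₀ σ₀′ Δ0σ₀ Δ0σ₀′ , compare-refuted <ᵍ σ₀ σ₀′ Δ0σ₀ Δ0σ₀′
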